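{- Let $\mathsf{Var}$ be a set and let all notation be as in the context. Then: (1) for all $A, B \in \mathsf{Tm}$, every map expression $f : A \Rightarrow B$ and every $N \in \mathsf{Nf}$, we have $\mathsf{nf}'_A\,N = \mathsf{nf}'_B\,N$, and (so that both sides are map expressions $A \otimes \mathsf{emb}\,N \Rightarrow \mathsf{emb}(\mathsf{nf}'_A\,N)$) $\mathsf{nm}'_A\,N \doteq \mathsf{nm}'_B\,N \circ (f \otimes \mathsf{id})$; (2) for all $A, B \in \mathsf{Tm}$ and every map expression $f : A \Rightarrow B$, we have $\mathsf{nf}\,A = \mathsf{nf}\,B$, and (so that both sides are map expressions $A \Rightarrow \mathsf{emb}(\mathsf{nf}\,A)$) $\mathsf{nm}\,A \doteq \mathsf{nm}\,B \circ f$.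
   Context: Fix a set $\mathsf{Var}$. Object expressions $\mathsf{Tm}$: for $X \in \mathsf{Var}$, $\mathsf{v}\,X \in \mathsf{Tm}$; $\mathsf{I} \in \mathsf{Tm}$; if $A,B\in\mathsf{Tm}$ then $A\otimes B \in \mathsf{Tm}$. For $A,B \in \mathsf{Tm}$, map expressions $A \Rightarrow B$ are generated by: $\mathsf{id} : A \Rightarrow A$; $f \circ g : A \Rightarrow C$ for $f : B \Rightarrow C$, $g : A \Rightarrow B$; $f \otimes g : A\otimes B \Rightarrow C \otimes D$ for $f : A \Rightarrow C$, $g : B \Rightarrow D$; $\lambda : \mathsf{I}\otimes A \Rightarrow A$; $\rho : A \Rightarrow A \otimes \mathsf{I}$; $\alpha : (A\otimes B)\otimes C \Rightarrow A\otimes(B\otimes C)$. The relation $\doteq$ between map expressions of the same type is the smallest relation closed under: reflexivity, symmetry, transitivity; if $f \doteq g$ and $h \doteq k$ then $f\circ h \doteq g \circ k$ and $f \otimes h \doteq g\otimes k$; $\mathsf{id}\circ f \doteq f$; $f \doteq f\circ \mathsf{id}$; $(f\circ g)\circ h \doteq f\circ(g\circ h)$; $\mathsf{id}\otimes\mathsf{id} \doteq \mathsf{id}$; $(h\circ f)\otimes(k\circ g) \doteq (h\otimes k)\circ(f\otimes g)$; $\lambda\circ(\mathsf{id}\otimes f) \doteq f\circ\lambda$; $\rho\circ f \doteq (f\otimes\mathsf{id})\circ\rho$; $\alpha\circ((f\otimes g)\otimes h) \doteq (f\otimes(g\otimes h))\circ\alpha$; $\lambda\circ\rho \doteq \mathsf{id}$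 (on $\mathsf{I}$); $\mathsf{id} \doteq (\mathsf{id}\otimes\lambda)\circ\alpha\circ(\rho\otimes\mathsf{id})$ (on $A \otimes B$); $\lambda\circ\alpha \doteq \lambda\otimes\mathsf{id}$; $\alpha\circ\rho \doteq \mathsf{id}\otimes\rho$; $\alpha\circ\alpha \doteq (\mathsf{id}\otimes\alpha)\circ\alpha\circ(\alpha\otimes\mathsf{id})$ (all instances well-typed). Normal forms $\mathsf{Nf}$: $\mathsf{J}\in\mathsf{Nf}$; $X \mathbin{`\otimes} N \in \mathsf{Nf}$ for $X\in\mathsf{Var}$, $N\in\mathsf{Nf}$. $\mathsf{emb}\,\mathsf{J} = \mathsf{I}$, $\mathsf{emb}(X \mathbin{`\otimes} N) = \mathsf{v}\,X\otimes\mathsf{emb}\,N$. $\mathsf{nf}'_{\mathsf{v}X}\,N = X \mathbin{`\otimes} N$, $\mathsf{nf}'_{\mathsf{I}}\,N = N$, $\mathsf{nf}'_{A\otimes B}\,N = \mathsf{nf}'_A(\mathsf{nf}'_B\,N)$; $\mathsf{nf}\,A = \mathsf{nf}'_A\,\mathsf{J}$. The map expressions $\mathsf{nm}'_A\,N : A\otimes\mathsf{emb}\,N \Rightarrow \mathsf{emb}(\mathsf{nf}'_A\,N)$ are defined recursively on $A$ by $\mathsf{nm}'_{\mathsf{v}X}\,N = \mathsf{id}$, $\mathsf{nm}'_{\mathsf{I}}\,N = \lambda$, $\mathsf{nm}'_{A\otimes B}\,N = \mathsf{nm}'_A(\mathsf{nf}'_B\,N)\circ(\mathsf{id}\otimes\mathsf{nm}'_B\,N)\circ\alpha$;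 and $\mathsf{nm}\,A : A \Rightarrow \mathsf{emb}(\mathsf{nf}\,A)$ is $\mathsf{nm}\,A = \mathsf{nm}'_A\,\mathsf{J}\circ\rho$. -}

module Defs where



module MonCat (Var : Set) where

  infixr 20 _⊗_
  data Tm : Set where
    v   : Var → Tm
    I   : Tm
    _⊗_ : Tm → Tm → Tm

  infixr 9 _∘_
  infixr 20 _⊗ₘ_
  data _⇒_ : Tm → Tm → Set where
    id    : ∀ {A} → A ⇒ A
    _∘_   : ∀ {A B C} → B ⇒ C → A ⇒ B → A ⇒ C
    _⊗ₘ_  : ∀ {A B C D} → A ⇒ C → B ⇒ D → (A ⊗ B) ⇒ (C ⊗ D)
    λ'    : ∀ {A} → (I ⊗ A) ⇒ A
    ρ     : ∀ {A} → A ⇒ (A ⊗ I)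
    α     : ∀ {A B C} → ((A ⊗ B) ⊗ C) ⇒ (A ⊗ (B ⊗ C))

  infix 4 _≐_
  data _≐_ : ∀ {A B} → A ⇒ B → A ⇒ B → Set where
    ≐refl   : ∀ {A B} {f : A ⇒ B} → f ≐ f
    ≐sym    : ∀ {A B} {f g : A ⇒ B} → f ≐ g → g ≐ f
    _∙_     : ∀ {A B} {f g h : A ⇒ B} → f ≐ g → g ≐ h → f ≐ h
    _∘≐_    : ∀ {A B C} {f g : B ⇒ C} {h k : A ⇒ B} → f ≐ g → h ≐ k → (f ∘ h) ≐ (g ∘ k)
    _⊗≐_    : ∀ {A B C D} {f g : A ⇒ C} {h k : B ⇒ D} → f ≐ g → h ≐ k → (f ⊗ₘ h) ≐ (g ⊗ₘ k)
    lid     : ∀ {A B} {f : A ⇒ B} → (id ∘ f) ≐ f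
    rid     : ∀ {A B} {f : A ⇒ B} → f ≐ (f ∘ id)
    ass     : ∀ {A B C D} {f : C ⇒ D} {g : B ⇒ C} {h : A ⇒ B} → ((f ∘ g) ∘ h) ≐ (f ∘ (g ∘ h))
    f⊗id    : ∀ {A B} → (id {A} ⊗ₘ id {B}) ≐ id
    f⊗∘     : ∀ {A B C D E F} {f : A ⇒ B} {g : D ⇒ E} {h : B ⇒ C} {k : E ⇒ F}
              → ((h ∘ f) ⊗ₘ (k ∘ g)) ≐ ((h ⊗ₘ k) ∘ (f ⊗ₘ g))
    nλ      : ∀ {A B} {f : A ⇒ B} → (λ' ∘ (id ⊗ₘ f)) ≐ (f ∘ λ')
    nρ      : ∀ {A B} {f : A ⇒ B} → (ρ ∘ f) ≐ ((f ⊗ₘ id) ∘ ρ)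
    nα      : ∀ {A B C D E F} {f : A ⇒ D} {g : B ⇒ E} {h : C ⇒ F}
              → (α ∘ ((f ⊗ₘ g) ⊗ₘ h)) ≐ ((f ⊗ₘ (g ⊗ₘ h)) ∘ α)
    lρ      : (λ' ∘ ρ) ≐ id {I}
    lαρ     : ∀ {A B} → id {A ⊗ B} ≐ ((id ⊗ₘ λ') ∘ α ∘ (ρ ⊗ₘ id))
    lα      : ∀ {A B} → (λ' ∘ α {I} {A} {B}) ≐ (λ' ⊗ₘ id)
    αρ      : ∀ {A B} → (α ∘ ρ {A ⊗ B}) ≐ (id ⊗ₘ ρ)
    pentagon : ∀ {A B C D} → (α ∘ α {A ⊗ B} {C} {D}) ≐ ((id ⊗ₘ α) ∘ α ∘ (α ⊗ₘ id))

  data Nf : Set where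
    J    : Nf
    _`⊗_ : Var → Nf → Nf

  emb : Nf → Tm
  emb J = I
  emb (X `⊗ N) = v X ⊗ emb N

  nf' : Tm → Nf → Nf
  nf' (v X) N = X `⊗ N
  nf' I N = N
  nf' (A ⊗ B) N = nf' A (nf' B N)

  nf : Tm → Nf
  nf A = nf' A J

  nm' : (A : Tm) (N : Nf) → (A ⊗ emb N) ⇒ emb (nf' A N)
  nm' (v X) N = id
  nm' I N = λ'
  nm' (A ⊗ B) N = nm' A (nf' B N) ∘ (id ⊗ₘ nm' B N) ∘ α

  nm : (A : Tm) → A ⇒ emb (nf A)
  nm A = nm' A J ∘ ρ

module Submission where

-- Since the codomains emb (nf' A N) and emb (nf' B N) only agree up to a
-- propositional equality of normal forms, we compare maps with different
-- normal-form codomains by the relation  g ≃ h : the normal forms agree and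
-- g ≐ h after transport.

open import Defs
open import Data.Product using (Σ; _×_; _,_)
open import Relation.Binary.Bundles using (Setoid)
open import Relation.Binary.PropositionalEquality using (_≡_; refl; subst; sym)
import Relation.Binary.Reasoning.Setoid as SetoidReasoning

module Naturality (Var : Set) where
  open MonCat Var

  ⇒-setoid : Tm → Tm → Setoid _ _
  ⇒-setoid A B = record
    { Carrier       = A ⇒ B
    ; _≈_           = _≐_
    ; isEquivalence = record { refl = ≐refl ; sym = ≐sym ; trans = _∙_ }
    }

  open module ≐-Reasoning {A B : Tm} = SetoidReasoning (⇒-setoid A B)
    using (begin_; step-≈-⟩; step-≈-⟨; _∎)

  ∘-congˡ : ∀ {A B C} {f : B ⇒ C} {g h : A ⇒ B} → g ≐ h → f ∘ g ≐ f ∘ h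
  ∘-congˡ p = ≐refl ∘≐ p

  ∘-congʳ : ∀ {A B C} {f g : B ⇒ C} {h : A ⇒ B} → f ≐ g → f ∘ h ≐ g ∘ h
  ∘-congʳ p = p ∘≐ ≐refl

  ∘-⊗id : ∀ {A B C D} {f : B ⇒ C} {g : A ⇒ B}
        → (f ∘ g) ⊗ₘ id {D} ≐ (f ⊗ₘ id) ∘ (g ⊗ₘ id)
  ∘-⊗id = (≐refl ⊗≐ ≐sym lid) ∙ f⊗∘

  ⊗-factor : ∀ {A B C D} {f : A ⇒ C} {k : B ⇒ D} → (f ⊗ₘ id) ∘ (id ⊗ₘ k) ≐ f ⊗ₘ k
  ⊗-factor = ≐sym f⊗∘ ∙ (≐sym rid ⊗≐ lid)

  ⊗-absorb : ∀ {A B C D E} {f : A ⇒ C} {h : B ⇒ D} {k : D ⇒ E}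
           → (id ⊗ₘ k) ∘ (f ⊗ₘ h) ≐ f ⊗ₘ (k ∘ h)
  ⊗-absorb = ≐sym f⊗∘ ∙ (lid ⊗≐ ≐refl)

  α-natʳ : ∀ {A B C D} {h : C ⇒ D}
         → α ∘ (id {A ⊗ B} ⊗ₘ h) ≐ (id ⊗ₘ (id ⊗ₘ h)) ∘ α
  α-natʳ = ∘-congˡ (≐sym f⊗id ⊗≐ ≐refl) ∙ nα

  -- Sliding f and g from the outside of α to its inside: the algebraic
  -- core of the tensor case of naturality.
  slide-through-α : ∀ {A B C D E F} {f : A ⇒ C} {g : B ⇒ D} {d : (D ⊗ E) ⇒ F}
                      {G} {c : (C ⊗ F) ⇒ G}
                  → ((c ∘ (f ⊗ₘ id)) ∘ (id ⊗ₘ (d ∘ (g ⊗ₘ id)))) ∘ α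
                    ≐ (c ∘ (id ⊗ₘ d) ∘ α) ∘ ((f ⊗ₘ g) ⊗ₘ id)
  slide-through-α {f = f} {g} {d} {c = c} = begin
    ((c ∘ (f ⊗ₘ id)) ∘ (id ⊗ₘ (d ∘ (g ⊗ₘ id)))) ∘ α ≈⟨ ∘-congʳ ass ⟩
    (c ∘ (f ⊗ₘ id) ∘ (id ⊗ₘ (d ∘ (g ⊗ₘ id)))) ∘ α   ≈⟨ ∘-congʳ (∘-congˡ ⊗-factor) ⟩
    (c ∘ (f ⊗ₘ (d ∘ (g ⊗ₘ id)))) ∘ α                ≈⟨ ∘-congʳ (∘-congˡ ⊗-absorb) ⟨
    (c ∘ (id ⊗ₘ d) ∘ (f ⊗ₘ (g ⊗ₘ id))) ∘ α          ≈⟨ ass ⟩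
    c ∘ ((id ⊗ₘ d) ∘ (f ⊗ₘ (g ⊗ₘ id))) ∘ α          ≈⟨ ∘-congˡ ass ⟩
    c ∘ (id ⊗ₘ d) ∘ (f ⊗ₘ (g ⊗ₘ id)) ∘ α            ≈⟨ ∘-congˡ (∘-congˡ nα) ⟨
    c ∘ (id ⊗ₘ d) ∘ α ∘ ((f ⊗ₘ g) ⊗ₘ id)            ≈⟨ ∘-congˡ ass ⟨
    c ∘ ((id ⊗ₘ d) ∘ α) ∘ ((f ⊗ₘ g) ⊗ₘ id)          ≈⟨ ass ⟨
    (c ∘ (id ⊗ₘ d) ∘ α) ∘ ((f ⊗ₘ g) ⊗ₘ id)          ∎

  cast : {X : Tm} {M M' : Nf} → M ≡ M' → X ⇒ emb M' → X ⇒ emb M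
  cast {X} e h = subst (λ M → X ⇒ emb M) (sym e) h

  infix 4 _≃_
  _≃_ : {X : Tm} {M M' : Nf} → X ⇒ emb M → X ⇒ emb M' → Set
  _≃_ {M = M} {M'} g h = Σ (M ≡ M') (λ e → g ≐ cast e h)

  ≐⇒≃ : ∀ {X M} {g h : X ⇒ emb M} → g ≐ h → g ≃ h
  ≐⇒≃ p = refl , p

  ≃-trans : ∀ {X M M' M''} {g : X ⇒ emb M} {h : X ⇒ emb M'} {k : X ⇒ emb M''}
          → g ≃ h → h ≃ k → g ≃ k
  ≃-trans (refl , p) (refl , q) = refl , p ∙ q

  ≃-∘ʳ : ∀ {X Y M M'} {g : Y ⇒ emb M} {h : Y ⇒ emb M'} {u : X ⇒ Y}
       → g ≃ h → g ∘ u ≃ h ∘ u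
  ≃-∘ʳ (refl , p) = refl , ∘-congʳ p

  nm'-resp-≃ : ∀ A {Y M M'} {g : Y ⇒ emb M} {h : Y ⇒ emb M'}
             → g ≃ h → nm' A M ∘ (id ⊗ₘ g) ≃ nm' A M' ∘ (id ⊗ₘ h)
  nm'-resp-≃ A (refl , p) = refl , ∘-congˡ (≐refl ⊗≐ p)

  infixr 2 _≃⟨_⟩_ _≐⟨_⟩_
  infix 3 _≃∎
  _≃⟨_⟩_ : ∀ {X M M' M''} (g : X ⇒ emb M) {h : X ⇒ emb M'} {k : X ⇒ emb M''}
         → g ≃ h → h ≃ k → g ≃ k
  g ≃⟨ p ⟩ q = ≃-trans p q

  _≐⟨_⟩_ : ∀ {X M M'} (g : X ⇒ emb M) {h : X ⇒ emb M} {k : X ⇒ emb M'}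
         → g ≐ h → h ≃ k → g ≃ k
  g ≐⟨ p ⟩ q = ≃-trans (≐⇒≃ p) q

  _≃∎ : ∀ {X M} (g : X ⇒ emb M) → g ≃ g
  g ≃∎ = ≐⇒≃ ≐refl

  -- The generator cases: here both sides have literally the same normal form.
  nm'-λ : ∀ A N → nm' (I ⊗ A) N ≐ nm' A N ∘ (λ' ⊗ₘ id)
  nm'-λ A N = begin
    λ' ∘ (id ⊗ₘ nm' A N) ∘ α   ≈⟨ ass ⟨
    (λ' ∘ (id ⊗ₘ nm' A N)) ∘ α ≈⟨ ∘-congʳ nλ ⟩
    (nm' A N ∘ λ') ∘ α         ≈⟨ ass ⟩
    nm' A N ∘ λ' ∘ α           ≈⟨ ∘-congˡ lα ⟩
    nm' A N ∘ (λ' ⊗ₘ id)       ∎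

  nm'-ρ : ∀ A N → nm' A N ≐ nm' (A ⊗ I) N ∘ (ρ ⊗ₘ id)
  nm'-ρ A N = begin
    nm' A N                                  ≈⟨ rid ⟩
    nm' A N ∘ id                             ≈⟨ ∘-congˡ lαρ ⟩
    nm' A N ∘ (id ⊗ₘ λ') ∘ α ∘ (ρ ⊗ₘ id)     ≈⟨ ∘-congˡ ass ⟨
    nm' A N ∘ ((id ⊗ₘ λ') ∘ α) ∘ (ρ ⊗ₘ id)   ≈⟨ ass ⟨
    (nm' A N ∘ (id ⊗ₘ λ') ∘ α) ∘ (ρ ⊗ₘ id)   ∎

  nm'-α : ∀ A B C N → nm' ((A ⊗ B) ⊗ C) N ≐ nm' (A ⊗ (B ⊗ C)) N ∘ (α ⊗ₘ id)
  nm'-α A B C N = begin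
    (a ∘ (id ⊗ₘ b) ∘ α) ∘ (id ⊗ₘ c) ∘ α                          ≈⟨ ass ⟩
    a ∘ ((id ⊗ₘ b) ∘ α) ∘ (id ⊗ₘ c) ∘ α                          ≈⟨ ∘-congˡ ass ⟩
    a ∘ (id ⊗ₘ b) ∘ α ∘ (id ⊗ₘ c) ∘ α                            ≈⟨ ∘-congˡ (∘-congˡ ass) ⟨
    a ∘ (id ⊗ₘ b) ∘ (α ∘ (id ⊗ₘ c)) ∘ α                          ≈⟨ ∘-congˡ (∘-congˡ (∘-congʳ α-natʳ)) ⟩
    a ∘ (id ⊗ₘ b) ∘ ((id ⊗ₘ (id ⊗ₘ c)) ∘ α) ∘ α                  ≈⟨ ∘-congˡ (∘-congˡ ass) ⟩
    a ∘ (id ⊗ₘ b) ∘ (id ⊗ₘ (id ⊗ₘ c)) ∘ α ∘ α                    ≈⟨ ∘-congˡ (∘-congˡ (∘-congˡ pentagon)) ⟩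
    a ∘ (id ⊗ₘ b) ∘ (id ⊗ₘ (id ⊗ₘ c)) ∘ (id ⊗ₘ α) ∘ α ∘ (α ⊗ₘ id) ≈⟨ ∘-congˡ (∘-congˡ ass) ⟨
    a ∘ (id ⊗ₘ b) ∘ ((id ⊗ₘ (id ⊗ₘ c)) ∘ (id ⊗ₘ α)) ∘ α ∘ (α ⊗ₘ id) ≈⟨ ∘-congˡ (∘-congˡ (∘-congʳ ⊗-absorb)) ⟩
    a ∘ (id ⊗ₘ b) ∘ (id ⊗ₘ ((id ⊗ₘ c) ∘ α)) ∘ α ∘ (α ⊗ₘ id)      ≈⟨ ∘-congˡ ass ⟨
    a ∘ ((id ⊗ₘ b) ∘ (id ⊗ₘ ((id ⊗ₘ c) ∘ α))) ∘ α ∘ (α ⊗ₘ id)    ≈⟨ ∘-congˡ (∘-congʳ ⊗-absorb) ⟩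
    a ∘ (id ⊗ₘ (b ∘ (id ⊗ₘ c) ∘ α)) ∘ α ∘ (α ⊗ₘ id)              ≈⟨ ∘-congˡ ass ⟨
    a ∘ ((id ⊗ₘ (b ∘ (id ⊗ₘ c) ∘ α)) ∘ α) ∘ (α ⊗ₘ id)            ≈⟨ ass ⟨
    (a ∘ (id ⊗ₘ (b ∘ (id ⊗ₘ c) ∘ α)) ∘ α) ∘ (α ⊗ₘ id)            ∎
    where
    a = nm' A (nf' B (nf' C N))
    b = nm' B (nf' C N)
    c = nm' C N

  nm'-natural : ∀ {A B} (f : A ⇒ B) N → nm' A N ≃ nm' B N ∘ (f ⊗ₘ id)
  nm'-natural id N = ≐⇒≃ (rid ∙ ∘-congˡ (≐sym f⊗id))
  nm'-natural {A} {C} (_∘_ {B = B} f g) N =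
    nm' A N                                   ≃⟨ nm'-natural g N ⟩
    nm' B N ∘ (g ⊗ₘ id)                       ≃⟨ ≃-∘ʳ (nm'-natural f N) ⟩
    (nm' C N ∘ (f ⊗ₘ id)) ∘ (g ⊗ₘ id)         ≐⟨ ass ∙ ∘-congˡ (≐sym ∘-⊗id) ⟩
    nm' C N ∘ ((f ∘ g) ⊗ₘ id)                 ≃∎
  nm'-natural (_⊗ₘ_ {A} {B} {C} {D} f g) N =
    nm' A (nf' B N) ∘ (id ⊗ₘ nm' B N) ∘ α                     ≐⟨ ≐sym ass ⟩
    (nm' A (nf' B N) ∘ (id ⊗ₘ nm' B N)) ∘ α                   ≃⟨ ≃-∘ʳ (nm'-resp-≃ A (nm'-natural g N)) ⟩
    (nm' A M ∘ (id ⊗ₘ (nm' D N ∘ (g ⊗ₘ id)))) ∘ α             ≃⟨ ≃-∘ʳ (≃-∘ʳ (nm'-natural f M)) ⟩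
    ((nm' C M ∘ (f ⊗ₘ id)) ∘ (id ⊗ₘ (nm' D N ∘ (g ⊗ₘ id)))) ∘ α ≐⟨ slide-through-α ⟩
    (nm' C M ∘ (id ⊗ₘ nm' D N) ∘ α) ∘ ((f ⊗ₘ g) ⊗ₘ id)        ≃∎
    where
    M = nf' D N
  nm'-natural (λ' {A}) N = ≐⇒≃ (nm'-λ A N)
  nm'-natural (ρ {A}) N = ≐⇒≃ (nm'-ρ A N)
  nm'-natural (α {A} {B} {C}) N = ≐⇒≃ (nm'-α A B C N)

  -- Naturality of nm: precompose the case N = J with ρ and use naturality of ρ.
  nm-natural : ∀ {A B} (f : A ⇒ B) → nm A ≃ nm B ∘ f
  nm-natural {A} {B} f =
    nm' A J ∘ ρ                     ≃⟨ ≃-∘ʳ (nm'-natural f J) ⟩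
    (nm' B J ∘ (f ⊗ₘ id)) ∘ ρ       ≐⟨ ass ∙ (∘-congˡ (≐sym nρ) ∙ ≐sym ass) ⟩
    (nm' B J ∘ ρ) ∘ f               ≃∎

proposition4 : (Var : Set) → let open MonCat Var in
    ((A B : Tm) (f : A ⇒ B) (N : Nf) →
      Σ (nf' A N ≡ nf' B N) (λ eq →
        nm' A N ≐ subst (λ M → (A ⊗ emb N) ⇒ emb M) (sym eq) (nm' B N ∘ (f ⊗ₘ id))))
    × ((A B : Tm) (f : A ⇒ B) →
      Σ (nf A ≡ nf B) (λ eq →
        nm A ≐ subst (λ M → A ⇒ emb M) (sym eq) (nm B ∘ f)))
proposition4 Var = (λ A B f N → nm'-natural f N) , (λ A B f → nm-natural f)
  where open Naturality Var
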